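{- For all integers $n\ge0$, $j\ge1$, every complex number $x$, and for each choice of sign (the same sign throughout), \[ \sum_{k=0}^n\binom{n}{k}2^kF_{jk}(\pm\sqrt5F_j)^{n-k}B_{n-k}(x)=nF_j\Big((\pm\sqrt5F_jx+L_j)^{n-1}+(\pm\sqrt5F_j(x-1)+L_j)^{n-1}\Big). \]
   Context: $F_n$ and $L_n$ denote the Fibonacci and Lucas numbers: $F_0=0,F_1=1$, $L_0=2,L_1=1$, and $u_n=u_{n-1}+u_{n-2}$. The Bernoulli polynomials $B_n(x)$ are defined by $\sum_{n\ge0}B_n(x)\frac{z^n}{n!}=\frac{ze^{xz}}{e^z-1}$. For $n=0$ the right-hand side is $0$. -}

module Defs where

open import Data.Nat as ℕ using (ℕ; zero; suc)
open import Data.Nat.Combinatorics using (_C_)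
open import Data.Integer using (+_)
open import Data.Rational as Q using (ℚ; 1ℚ; 0ℚ)
open import Data.List using (List; []; _∷_; _++_; length; lookup)
open import Algebra.Bundles using (CommutativeRing)

fib : ℕ → ℕ
fib 0 = 0
fib 1 = 1
fib (suc (suc n)) = fib (suc n) ℕ.+ fib n

luc : ℕ → ℕ
luc 0 = 2
luc 1 = 1
luc (suc (suc n)) = luc (suc n) ℕ.+ luc n

ℕtoℚ : ℕ → ℚ
ℕtoℚ n = + n / 1
  where open Q using (_/_)

-- Bernoulli numbers (convention of z/(eᶻ-1), so B₁ = -1/2), via the
-- recurrence equivalent to that generating function:
--   B₀ = 1,   Σ_{k=0}^{m} C(m+1,k) B_k = 0   (m ≥ 1).
-- bernUpTo m = [B₀, …, B_m].

private
  weighted : ℕ → ℕ → List ℚ → ℚ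
  weighted m k [] = 0ℚ
  weighted m k (b ∷ bs) = Q._+_ (Q._*_ (ℕtoℚ ((suc m) C k)) b) (weighted m (suc k) bs)

bernUpTo : ℕ → List ℚ
bernUpTo zero = 1ℚ ∷ []
bernUpTo (suc m) = bs ++ (nxt ∷ [])
  where
  bs = bernUpTo m
  nxt = Q.-_ (Q._*_ (Q._/_ (+ 1) (suc (suc m))) (weighted (suc m) 0 bs))

-- the last element of a list (0 on the empty list, which never occurs here)
lastOr0 : List ℚ → ℚ
lastOr0 [] = 0ℚ
lastOr0 (b ∷ []) = b
lastOr0 (b ∷ c ∷ bs) = lastOr0 (c ∷ bs)

bernoulli : ℕ → ℚ
bernoulli n = lastOr0 (bernUpTo n)

-- Notions inside a commutative ring R equipped with a map ι : ℚ → R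
-- (in the theorem, ι is required to be a ring homomorphism, i.e. R is a ℚ-algebra).
module QAlgebra {c ℓ} (R : CommutativeRing c ℓ) (ι : ℚ → CommutativeRing.Carrier R) where
  open CommutativeRing R

  nat : ℕ → Carrier
  nat n = ι (ℕtoℚ n)

  pow : Carrier → ℕ → Carrier
  pow x zero = 1#
  pow x (suc n) = x * pow x n

  sumTo : ℕ → (ℕ → Carrier) → Carrier
  sumTo zero f = f 0
  sumTo (suc n) f = sumTo n f + f (suc n)

  bernPoly : ℕ → Carrier → Carrier
  bernPoly n x = sumTo n (λ k → nat (n C k) * (ι (bernoulli k) * pow x (n ℕ.∸ k)))

-- With α, β = (1 ± √5)/2 put u = 2αʲ = Lⱼ + √5 Fⱼ and v = 2βʲ = Lⱼ − √5 Fⱼ, so that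
-- uᵏ − vᵏ = 2ᵏ √5 F_{jk}, and let h = √5 Fⱼ.  The polynomials Aₙ(z) = Σₘ C(n,m) Bₘ hᵐ z^{n−m}
-- = hⁿ Bₙ(z/h) form an Appell sequence, Aₙ(z + y) = Σₖ C(n,k) yᵏ A_{n−k}(z); hence √5 times
-- the left-hand side is Aₙ(hx + u) − Aₙ(hx + v).  Now hx + v = w := h(x − 1) + Lⱼ and
-- hx + u = w + 2h, and the difference equation Aₙ(z + h) − Aₙ(z) = n h z^{n−1}, which is
-- Bₙ(t + 1) − Bₙ(t) = n t^{n−1}, applied twice turns this into n h (w^{n−1} + (w + h)^{n−1}),
-- √5 times the right-hand side.  In a ℚ-algebra √5 is invertible, so it cancels.
-- The product rule (Lₐ + tFₐ)(L_b + tF_b) = 2(L_{a+b} + tF_{a+b}) for t² = 5 behind uᵏ is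
-- checked on two initial values, both sides being Fibonacci-like in each index.

{-# OPTIONS --safe #-}
module Submission where

open import Defs
open import Data.Nat using (ℕ; _≤_; _∸_)
open import Data.Nat as N using (zero; suc; z≤n)
import Data.Nat.Properties as N
open import Data.Nat.Combinatorics using (_C_; nCk+nC[k+1]≡[n+1]C[k+1]; nCk≡nC[n∸k]; nC1≡n; nCn≡1)
open import Data.Nat.Combinatorics.Specification using (k>n⇒nCk≡0)
open import Data.Nat.Coprimality using (1-coprimeTo) renaming (sym to coprime-sym)
open import Data.Integer as ℤ using (+_)
open import Data.Integer.Tactic.RingSolver using (solve-∀)
open import Data.Rational as ℚ using (ℚ; 1ℚ; 0ℚ; mkℚ; toℚᵘ; _≟_)
open import Data.Rational.Properties as ℚ using (+-*-commutativeRing; normalize-coprime; toℚᵘ-injective; toℚᵘ-homo-+)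
import Data.Rational.Unnormalised as ℚᵘ
import Data.Rational.Unnormalised.Properties as ℚᵘ
open import Data.List using (List; []; _∷_; _++_; length)
import Data.List.Properties as List
open import Data.Maybe using (Maybe; just; nothing)
open import Data.Product using (_×_; _,_; proj₁)
open import Relation.Nullary using (yes; no)
open import Relation.Binary.PropositionalEquality as ≡ using (_≡_; cong)
import Relation.Binary.Reasoning.Setoid as SetoidReasoning
open import Algebra.Bundles using (CommutativeRing)
open import Algebra.Morphism.Structures using (module RingMorphisms)
open import Algebra.Solver.Ring.AlmostCommutativeRing using (fromCommutativeRing; _-Raw-AlmostCommutative⟶_)
import Algebra.Solver.Ring
import Algebra.Properties.Group as GroupProperties

ℕtoℚ≡mkℚ : ∀ n → ℕtoℚ n ≡ mkℚ (+ n) 0 (coprime-sym (1-coprimeTo n))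
ℕtoℚ≡mkℚ n = normalize-coprime (coprime-sym (1-coprimeTo n))

toℚᵘ-ℕtoℚ : ∀ n → toℚᵘ (ℕtoℚ n) ≡ ℚᵘ.mkℚᵘ (+ n) 0
toℚᵘ-ℕtoℚ n = cong toℚᵘ (ℕtoℚ≡mkℚ n)

mkℚᵘ-homo-+ : ∀ x y → ℚᵘ.mkℚᵘ (x ℤ.+ y) 0 ℚᵘ.≃ ℚᵘ.mkℚᵘ x 0 ℚᵘ.+ ℚᵘ.mkℚᵘ y 0
mkℚᵘ-homo-+ x y = ℚᵘ.*≡* (≡.sym (eq x y))
  where
  eq : ∀ x y → (x ℤ.* + 1 ℤ.+ y ℤ.* + 1) ℤ.* + 1 ≡ (x ℤ.+ y) ℤ.* + 1
  eq = solve-∀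

ℕtoℚ-+ : ∀ a b → ℕtoℚ (a N.+ b) ≡ ℕtoℚ a ℚ.+ ℕtoℚ b
ℕtoℚ-+ a b = toℚᵘ-injective (begin
  toℚᵘ (ℕtoℚ (a N.+ b))                   ≡⟨ toℚᵘ-ℕtoℚ (a N.+ b) ⟩
  ℚᵘ.mkℚᵘ (+ a ℤ.+ + b) 0                 ≈⟨ mkℚᵘ-homo-+ (+ a) (+ b) ⟩
  ℚᵘ.mkℚᵘ (+ a) 0 ℚᵘ.+ ℚᵘ.mkℚᵘ (+ b) 0    ≡⟨ ≡.cong₂ ℚᵘ._+_ (toℚᵘ-ℕtoℚ a) (toℚᵘ-ℕtoℚ b) ⟨
  toℚᵘ (ℕtoℚ a) ℚᵘ.+ toℚᵘ (ℕtoℚ b)        ≈⟨ toℚᵘ-homo-+ (ℕtoℚ a) (ℕtoℚ b) ⟨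
  toℚᵘ (ℕtoℚ a ℚ.+ ℕtoℚ b)                ∎)
  where open SetoidReasoning ℚᵘ.≃-setoid

ℕtoℚ-*-inverse : ∀ k → ℕtoℚ (suc k) ℚ.* (+ 1 ℚ./ suc k) ≡ 1ℚ
ℕtoℚ-*-inverse k
  rewrite ℕtoℚ≡mkℚ (suc k) | normalize-coprime {1} {k} (1-coprimeTo (suc k))
  = ℚ.*-inverseʳ (mkℚ (+ suc k) 0 (coprime-sym (1-coprimeTo (suc k))))

lastOr0-∷ʳ : ∀ xs y → lastOr0 (xs ++ y ∷ []) ≡ y
lastOr0-∷ʳ []           y = ≡.refl
lastOr0-∷ʳ (x ∷ [])     y = ≡.refl
lastOr0-∷ʳ (x ∷ x′ ∷ xs) y = lastOr0-∷ʳ (x′ ∷ xs) y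

-- Defs keeps private the sum  weighted M K bs = Σᵢ C(M+1, K+i) bsᵢ  of the Bernoulli recurrence;
-- these metavariables are solved to it by unification with the unfolding of bernUpTo (suc m).
mutual
  weighted : ℕ → ℕ → List ℚ → ℚ
  weighted = _

  private
    weighted₀ : ℕ → List ℚ → ℚ
    weighted₀ = _

    bernUpTo-suc-weighted₀ : ∀ m → bernUpTo (suc m) ≡ bernUpTo m ++ ℚ.- ((+ 1 ℚ./ suc (suc m)) ℚ.* weighted₀ m (bernUpTo m)) ∷ []
    bernUpTo-suc-weighted₀ m with bernUpTo m
    ... | L = ≡.refl

    weighted₀≡weighted : ∀ m L → weighted₀ m L ≡ weighted (suc m) 0 L
    weighted₀≡weighted m L with suc m | 0
    ... | M | K = ≡.refl

    bernoulli-suc-weighted₀ : ∀ m → bernoulli (suc m) ≡ ℚ.- ((+ 1 ℚ./ suc (suc m)) ℚ.* weighted₀ m (bernUpTo m))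
    bernoulli-suc-weighted₀ m = ≡.trans (cong lastOr0 (bernUpTo-suc-weighted₀ m)) (lastOr0-∷ʳ (bernUpTo m) _)

bernoulli-suc : ∀ m → bernoulli (suc m) ≡ ℚ.- ((+ 1 ℚ./ suc (suc m)) ℚ.* weighted (suc m) 0 (bernUpTo m))
bernoulli-suc m = ≡.trans (bernoulli-suc-weighted₀ m) (cong (λ w → ℚ.- ((+ 1 ℚ./ suc (suc m)) ℚ.* w)) (weighted₀≡weighted m (bernUpTo m)))

bernUpTo-suc : ∀ m → bernUpTo (suc m) ≡ bernUpTo m ++ bernoulli (suc m) ∷ []
bernUpTo-suc m = ≡.trans (bernUpTo-suc-weighted₀ m) (cong (λ b → bernUpTo m ++ b ∷ []) (≡.sym (bernoulli-suc-weighted₀ m)))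

length-bernUpTo : ∀ m → length (bernUpTo m) ≡ suc m
length-bernUpTo zero    = ≡.refl
length-bernUpTo (suc m) = begin
  length (bernUpTo (suc m))                         ≡⟨ cong length (bernUpTo-suc m) ⟩
  length (bernUpTo m ++ bernoulli (suc m) ∷ [])     ≡⟨ List.length-++ (bernUpTo m) ⟩
  length (bernUpTo m) N.+ 1                          ≡⟨ cong (N._+ 1) (length-bernUpTo m) ⟩
  suc m N.+ 1                                        ≡⟨ N.+-comm (suc m) 1 ⟩
  suc (suc m)                                        ∎
  where open ≡.≡-Reasoning

weighted-++ : ∀ M K xs ys → weighted M K (xs ++ ys) ≡ weighted M K xs ℚ.+ weighted M (K N.+ length xs) ys
weighted-++ M K [] ys = ≡.trans (cong (λ k → weighted M k ys) (≡.sym (N.+-identityʳ K))) (≡.sym (ℚ.+-identityˡ _))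
weighted-++ M K (x ∷ xs) ys = begin
  c ℚ.+ weighted M (suc K) (xs ++ ys)
    ≡⟨ cong (c ℚ.+_) (weighted-++ M (suc K) xs ys) ⟩
  c ℚ.+ (weighted M (suc K) xs ℚ.+ weighted M (suc K N.+ length xs) ys)
    ≡⟨ ℚ.+-assoc c _ _ ⟨
  (c ℚ.+ weighted M (suc K) xs) ℚ.+ weighted M (suc K N.+ length xs) ys
    ≡⟨ cong (λ k → (c ℚ.+ weighted M (suc K) xs) ℚ.+ weighted M k ys) (N.+-suc K (length xs)) ⟨
  (c ℚ.+ weighted M (suc K) xs) ℚ.+ weighted M (K N.+ suc (length xs)) ys ∎
  where
  open ≡.≡-Reasoning
  c = ℕtoℚ (suc M C K) ℚ.* x

module FibonacciLike {c ℓ} (R : CommutativeRing c ℓ) where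
  open CommutativeRing R

  IsFibonacciLike : (ℕ → Carrier) → Set ℓ
  IsFibonacciLike g = ∀ n → g (suc (suc n)) ≈ g (suc n) + g n

  fibonacciLike-unique : ∀ {g h} → IsFibonacciLike g → IsFibonacciLike h →
                         g 0 ≈ h 0 → g 1 ≈ h 1 → ∀ n → g n ≈ h n
  fibonacciLike-unique {g} {h} fib-g fib-h e₀ e₁ n = proj₁ (pairs n)
    where
    pairs : ∀ n → g n ≈ h n × g (suc n) ≈ h (suc n)
    pairs zero    = e₀ , e₁
    pairs (suc n) with pairs n
    ... | eₙ , eₙ₊₁ = eₙ₊₁ , trans (fib-g n) (trans (+-cong eₙ₊₁ eₙ) (sym (fib-h n)))

  fibonacciLike-*ˡ : ∀ a {g} → IsFibonacciLike g → IsFibonacciLike (λ n → a * g n)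
  fibonacciLike-*ˡ a fib-g n = trans (*-congˡ (fib-g n)) (distribˡ a _ _)

  fibonacciLike-*ʳ : ∀ a {g} → IsFibonacciLike g → IsFibonacciLike (λ n → g n * a)
  fibonacciLike-*ʳ a fib-g n = trans (*-congʳ (fib-g n)) (distribʳ a _ _)

module SumsAndPowers {c ℓ} (R : CommutativeRing c ℓ) (ι : ℚ → CommutativeRing.Carrier R) where
  open CommutativeRing R
  open QAlgebra R ι
  open SetoidReasoning setoid
  open import Algebra.Properties.CommutativeSemigroup +-commutativeSemigroup
    using () renaming (interchange to +-interchange)
  open import Algebra.Properties.CommutativeSemigroup *-commutativeSemigroup
    using () renaming (interchange to *-interchange; x∙yz≈y∙xz to x*yz≈y*xz)

  sumTo-cong-≤ : ∀ n {f g : ℕ → Carrier} → (∀ k → k N.≤ n → f k ≈ g k) → sumTo n f ≈ sumTo n g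
  sumTo-cong-≤ zero    f≈g = f≈g 0 z≤n
  sumTo-cong-≤ (suc n) f≈g = +-cong (sumTo-cong-≤ n (λ k k≤n → f≈g k (N.m≤n⇒m≤1+n k≤n))) (f≈g (suc n) N.≤-refl)

  sumTo-cong : ∀ n {f g : ℕ → Carrier} → (∀ k → f k ≈ g k) → sumTo n f ≈ sumTo n g
  sumTo-cong n f≈g = sumTo-cong-≤ n (λ k _ → f≈g k)

  sumTo-+ : ∀ n (f g : ℕ → Carrier) → sumTo n (λ k → f k + g k) ≈ sumTo n f + sumTo n g
  sumTo-+ zero    f g = refl
  sumTo-+ (suc n) f g = trans (+-congʳ (sumTo-+ n f g)) (+-interchange _ _ _ _)

  *-distribˡ-sumTo : ∀ n a (f : ℕ → Carrier) → a * sumTo n f ≈ sumTo n (λ k → a * f k)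
  *-distribˡ-sumTo zero    a f = refl
  *-distribˡ-sumTo (suc n) a f = trans (distribˡ a _ _) (+-congʳ (*-distribˡ-sumTo n a f))

  sumTo-sucˡ : ∀ n (f : ℕ → Carrier) → sumTo (suc n) f ≈ f 0 + sumTo n (λ k → f (suc k))
  sumTo-sucˡ zero    f = refl
  sumTo-sucˡ (suc n) f = trans (+-congʳ (sumTo-sucˡ n f)) (+-assoc _ _ _)

  sumTo-head : ∀ n (f : ℕ → Carrier) → (∀ k → f (suc k) ≈ 0#) → sumTo n f ≈ f 0
  sumTo-head zero    f f≈0 = refl
  sumTo-head (suc n) f f≈0 = trans (+-cong (sumTo-head n f f≈0) (f≈0 n)) (+-identityʳ _)

  sumTo-reverse : ∀ n (f : ℕ → Carrier) → sumTo n f ≈ sumTo n (λ k → f (n ∸ k))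
  sumTo-reverse zero    f = refl
  sumTo-reverse (suc n) f = sym (begin
    sumTo (suc n) (λ k → f (suc n ∸ k)) ≈⟨ sumTo-sucˡ n (λ k → f (suc n ∸ k)) ⟩
    f (suc n) + sumTo n (λ k → f (n ∸ k)) ≈⟨ +-congˡ (sumTo-reverse n f) ⟨
    f (suc n) + sumTo n f                 ≈⟨ +-comm _ _ ⟩
    sumTo n f + f (suc n)                 ∎)

  pow-cong : ∀ n {x y} → x ≈ y → pow x n ≈ pow y n
  pow-cong zero    x≈y = refl
  pow-cong (suc n) x≈y = *-cong x≈y (pow-cong n x≈y)

  pow-+ : ∀ x a b → pow x (a N.+ b) ≈ pow x a * pow x b
  pow-+ x zero    b = sym (*-identityˡ _)
  pow-+ x (suc a) b = trans (*-congˡ (pow-+ x a b)) (sym (*-assoc _ _ _))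

  pow-* : ∀ x y n → pow (x * y) n ≈ pow x n * pow y n
  pow-* x y zero    = sym (*-identityˡ _)
  pow-* x y (suc n) = trans (*-congˡ (pow-* x y n)) (*-interchange _ _ _ _)

  pow-scaledMultiplicative : ∀ {g : ℕ → Carrier} {a} →
    (∀ i j → g i * g j ≈ a * g (i N.+ j)) → g 0 ≈ a →
    ∀ j k → a * pow (g j) k ≈ pow a k * g (j N.* k)
  pow-scaledMultiplicative {g} {a} g-mult g₀ j zero = begin
    a * 1#            ≈⟨ *-identityʳ a ⟩
    a                 ≈⟨ g₀ ⟨
    g 0               ≈⟨ reflexive (cong g (N.*-zeroʳ j)) ⟨
    g (j N.* 0)       ≈⟨ *-identityˡ _ ⟨
    1# * g (j N.* 0)  ∎
  pow-scaledMultiplicative {g} {a} g-mult g₀ j (suc k) = begin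
    a * (g j * pow (g j) k)           ≈⟨ x*yz≈y*xz a _ _ ⟩
    g j * (a * pow (g j) k)           ≈⟨ *-congˡ (pow-scaledMultiplicative g-mult g₀ j k) ⟩
    g j * (pow a k * g (j N.* k))     ≈⟨ x*yz≈y*xz _ _ _ ⟩
    pow a k * (g j * g (j N.* k))     ≈⟨ *-congˡ (g-mult j (j N.* k)) ⟩
    pow a k * (a * g (j N.+ j N.* k)) ≈⟨ x*yz≈y*xz _ _ _ ⟩
    a * (pow a k * g (j N.+ j N.* k)) ≈⟨ *-assoc _ _ _ ⟨
    a * pow a k * g (j N.+ j N.* k)   ≈⟨ *-congˡ (reflexive (cong g (N.*-suc j k))) ⟨
    a * pow a k * g (j N.* suc k)     ∎

module QAlgebraProperties {c ℓ} (R : CommutativeRing c ℓ) (ι : ℚ → CommutativeRing.Carrier R)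
  (ι-hom : RingMorphisms.IsRingHomomorphism (CommutativeRing.rawRing +-*-commutativeRing) (CommutativeRing.rawRing R) ι)
  where
  open CommutativeRing R
  open QAlgebra R ι
  open RingMorphisms.IsRingHomomorphism ι-hom
  open FibonacciLike R
  open SumsAndPowers R ι
  open SetoidReasoning setoid

  ι-morphism : CommutativeRing.rawRing +-*-commutativeRing -Raw-AlmostCommutative⟶ fromCommutativeRing R
  ι-morphism = record
    { ⟦_⟧ = ι ; +-homo = +-homo ; *-homo = *-homo ; -‿homo = -‿homo ; 0-homo = 0#-homo ; 1-homo = 1#-homo }

  ι-≟ : ∀ p q → Maybe (ι p ≈ ι q)
  ι-≟ p q with p ≟ q
  ... | yes ≡.refl = just refl
  ... | no _       = nothing

  module Solver = Algebra.Solver.Ring (CommutativeRing.rawRing +-*-commutativeRing) (fromCommutativeRing R) ι-morphism ι-≟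
  open Solver using (solve; _:+_; _:*_; _:-_; :-_; _:=_; con)

  nat-+ : ∀ a b → nat (a N.+ b) ≈ nat a + nat b
  nat-+ a b = trans (reflexive (cong ι (ℕtoℚ-+ a b))) (+-homo (ℕtoℚ a) (ℕtoℚ b))

  nat-cong : ∀ {a b} → a ≡ b → nat a ≈ nat b
  nat-cong a≡b = reflexive (cong nat a≡b)

  ι-inverse-nat : ∀ k → ι (+ 1 ℚ./ suc k) * nat (suc k) ≈ 1#
  ι-inverse-nat k = trans (*-comm _ _) (trans (sym (*-homo _ _)) (trans (reflexive (cong ι (ℕtoℚ-*-inverse k))) 1#-homo))

  *-cancelˡ-invertible : ∀ {a b x y} → b * a ≈ 1# → a * x ≈ a * y → x ≈ y
  *-cancelˡ-invertible {a} {b} {x} {y} ba≈1 ax≈ay = begin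
    x             ≈⟨ *-identityˡ x ⟨
    1# * x        ≈⟨ *-congʳ ba≈1 ⟨
    (b * a) * x   ≈⟨ *-assoc b a x ⟩
    b * (a * x)   ≈⟨ *-congˡ ax≈ay ⟩
    b * (a * y)   ≈⟨ *-assoc b a y ⟨
    (b * a) * y   ≈⟨ *-congʳ ba≈1 ⟩
    1# * y        ≈⟨ *-identityˡ y ⟩
    y             ∎

  sumTo-pascal : ∀ n (g : ℕ → Carrier) →
    sumTo (suc n) (λ k → nat (suc n C k) * g k)
      ≈ sumTo n (λ k → nat (n C k) * g k) + sumTo n (λ k → nat (n C k) * g (suc k))
  sumTo-pascal n g = begin
    sumTo (suc n) (λ k → nat (suc n C k) * g k)
      ≈⟨ sumTo-sucˡ n _ ⟩
    g₀ + sumTo n (λ k → nat (suc n C suc k) * g (suc k))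
      ≈⟨ +-congˡ (sumTo-cong n pascal) ⟩
    g₀ + sumTo n (λ k → nat (n C k) * g (suc k) + nat (n C suc k) * g (suc k))
      ≈⟨ +-congˡ (sumTo-+ n _ _) ⟩
    g₀ + (sumTo n (λ k → nat (n C k) * g (suc k)) + sumTo n (λ k → nat (n C suc k) * g (suc k)))
      ≈⟨ solve 3 (λ a b c → a :+ (b :+ c) := (a :+ c) :+ b) refl _ _ _ ⟩
    (g₀ + sumTo n (λ k → nat (n C suc k) * g (suc k))) + sumTo n (λ k → nat (n C k) * g (suc k))
      ≈⟨ +-congʳ (sumTo-sucˡ n (λ k → nat (n C k) * g k)) ⟨
    sumTo (suc n) (λ k → nat (n C k) * g k) + sumTo n (λ k → nat (n C k) * g (suc k))
      ≈⟨ +-congʳ (+-congˡ vanishing) ⟩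
    sumTo n (λ k → nat (n C k) * g k) + 0# + sumTo n (λ k → nat (n C k) * g (suc k))
      ≈⟨ +-congʳ (+-identityʳ _) ⟩
    sumTo n (λ k → nat (n C k) * g k) + sumTo n (λ k → nat (n C k) * g (suc k)) ∎
    where
    g₀ = nat 1 * g 0
    pascal : ∀ k → nat (suc n C suc k) * g (suc k) ≈ nat (n C k) * g (suc k) + nat (n C suc k) * g (suc k)
    pascal k = trans (*-congʳ (trans (nat-cong (≡.sym (nCk+nC[k+1]≡[n+1]C[k+1] n k))) (nat-+ (n C k) (n C suc k)))) (distribʳ _ _ _)
    vanishing : nat (n C suc n) * g (suc n) ≈ 0#
    vanishing = trans (*-congʳ (trans (nat-cong (k>n⇒nCk≡0 (N.n<1+n n))) 0#-homo)) (zeroˡ _)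

  appell : (ℕ → Carrier) → ℕ → Carrier → Carrier
  appell a n z = sumTo n (λ m → nat (n C m) * (a m * pow z (n ∸ m)))

  appell-cong : ∀ a n {z z′} → z ≈ z′ → appell a n z ≈ appell a n z′
  appell-cong a n z≈z′ = sumTo-cong n (λ m → *-congˡ (*-congˡ (pow-cong (n ∸ m) z≈z′)))

  appell-suc : ∀ a n z → appell a (suc n) z ≈ z * appell a n z + appell (λ m → a (suc m)) n z
  appell-suc a n z = trans (sumTo-pascal n (λ m → a m * pow z (suc n ∸ m)))
    (+-congʳ (trans (sumTo-cong-≤ n step) (sym (*-distribˡ-sumTo n z _))))
    where
    step : ∀ m → m N.≤ n → nat (n C m) * (a m * pow z (suc n ∸ m)) ≈ z * (nat (n C m) * (a m * pow z (n ∸ m)))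
    step m m≤n = trans (*-congˡ (*-congˡ (reflexive (cong (pow z) (N.+-∸-assoc 1 m≤n)))))
      (solve 4 (λ C b p w → C :* (b :* (w :* p)) := w :* (C :* (b :* p))) refl _ _ _ _)

  appell-+ : ∀ a n z y → appell a n (z + y) ≈ sumTo n (λ k → nat (n C k) * (pow y k * appell a (n ∸ k) z))
  appell-+ a zero    z y = *-congˡ (sym (trans (*-identityˡ _) (trans (*-congʳ 1#-homo) (*-identityˡ _))))
  appell-+ a (suc n) z y = sym (begin
    sumTo (suc n) (λ k → nat (suc n C k) * (pow y k * appell a (suc n ∸ k) z))
      ≈⟨ sumTo-pascal n (λ k → pow y k * appell a (suc n ∸ k) z) ⟩
    sumTo n (λ k → nat (n C k) * (pow y k * appell a (suc n ∸ k) z))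
      + sumTo n (λ k → nat (n C k) * (pow y (suc k) * appell a (n ∸ k) z))
      ≈⟨ +-cong (sumTo-cong-≤ n unfold-suc) (sumTo-cong n (λ k → solve 4 (λ C b p q → C :* ((b :* p) :* q) := b :* (C :* (p :* q))) refl _ _ _ _)) ⟩
    sumTo n (λ k → z * (nat (n C k) * (pow y k * appell a (n ∸ k) z)) + nat (n C k) * (pow y k * appell a⁺ (n ∸ k) z))
      + sumTo n (λ k → y * (nat (n C k) * (pow y k * appell a (n ∸ k) z)))
      ≈⟨ +-cong (trans (sumTo-+ n _ _) (+-congʳ (sym (*-distribˡ-sumTo n z _)))) (sym (*-distribˡ-sumTo n y _)) ⟩
    (z * T a + T a⁺) + y * T a
      ≈⟨ +-cong (+-cong (*-congˡ (sym (appell-+ a n z y))) (sym (appell-+ a⁺ n z y))) (*-congˡ (sym (appell-+ a n z y))) ⟩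
    (z * appell a n (z + y) + appell a⁺ n (z + y)) + y * appell a n (z + y)
      ≈⟨ solve 4 (λ z q r y → (z :* q :+ r) :+ y :* q := (z :+ y) :* q :+ r) refl _ _ _ _ ⟩
    (z + y) * appell a n (z + y) + appell a⁺ n (z + y)
      ≈⟨ appell-suc a n (z + y) ⟨
    appell a (suc n) (z + y) ∎)
    where
    a⁺ : ℕ → Carrier
    a⁺ m = a (suc m)
    T : (ℕ → Carrier) → Carrier
    T b = sumTo n (λ k → nat (n C k) * (pow y k * appell b (n ∸ k) z))
    unfold-suc : ∀ k → k N.≤ n → nat (n C k) * (pow y k * appell a (suc n ∸ k) z)
                 ≈ z * (nat (n C k) * (pow y k * appell a (n ∸ k) z)) + nat (n C k) * (pow y k * appell a⁺ (n ∸ k) z)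
    unfold-suc k k≤n = trans (*-congˡ (*-congˡ (trans (reflexive (cong (λ m → appell a m z) (N.+-∸-assoc 1 k≤n))) (appell-suc a (n ∸ k) z))))
      (solve 5 (λ C p w q r → C :* (p :* (w :* q :+ r)) := w :* (C :* (p :* q)) :+ C :* (p :* r)) refl _ _ _ _ _)

  appell-+-powDifference : ∀ a n z y y′ (d : ℕ → Carrier) → (∀ k → pow y k ≈ pow y′ k + d k) →
    appell a n (z + y) ≈ appell a n (z + y′) + sumTo n (λ k → nat (n C k) * (d k * appell a (n ∸ k) z))
  appell-+-powDifference a n z y y′ d y≈y′+d = begin
    appell a n (z + y)
      ≈⟨ appell-+ a n z y ⟩
    sumTo n (λ k → nat (n C k) * (pow y k * appell a (n ∸ k) z))
      ≈⟨ sumTo-cong n (λ k → trans (*-congˡ (*-congʳ (y≈y′+d k))) (solve 4 (λ C p d q → C :* ((p :+ d) :* q) := C :* (p :* q) :+ C :* (d :* q)) refl _ _ _ _)) ⟩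
    sumTo n (λ k → nat (n C k) * (pow y′ k * appell a (n ∸ k) z) + nat (n C k) * (d k * appell a (n ∸ k) z))
      ≈⟨ sumTo-+ n _ _ ⟩
    sumTo n (λ k → nat (n C k) * (pow y′ k * appell a (n ∸ k) z)) + sumTo n (λ k → nat (n C k) * (d k * appell a (n ∸ k) z))
      ≈⟨ +-congʳ (appell-+ a n z y′) ⟨
    appell a n (z + y′) + sumTo n (λ k → nat (n C k) * (d k * appell a (n ∸ k) z)) ∎

  ι-weighted-[_] : ∀ y M K → ι (weighted M K (y ∷ [])) ≈ nat (suc M C K) * ι y
  ι-weighted-[ y ] M K = trans (+-homo _ _) (trans (+-congˡ 0#-homo) (trans (+-identityʳ _) (*-homo _ _)))

  ι-weighted-bernUpTo : ∀ M m → ι (weighted M 0 (bernUpTo m)) ≈ sumTo m (λ k → nat (suc M C k) * ι (bernoulli k))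
  ι-weighted-bernUpTo M zero    = ι-weighted-[ 1ℚ ] M 0
  ι-weighted-bernUpTo M (suc m) = begin
    ι (weighted M 0 (bernUpTo (suc m)))
      ≡⟨ cong (λ bs → ι (weighted M 0 bs)) (bernUpTo-suc m) ⟩
    ι (weighted M 0 (bernUpTo m ++ bernoulli (suc m) ∷ []))
      ≡⟨ cong ι (weighted-++ M 0 (bernUpTo m) _) ⟩
    ι (weighted M 0 (bernUpTo m) ℚ.+ weighted M (length (bernUpTo m)) (bernoulli (suc m) ∷ []))
      ≈⟨ +-homo _ _ ⟩
    ι (weighted M 0 (bernUpTo m)) + ι (weighted M (length (bernUpTo m)) (bernoulli (suc m) ∷ []))
      ≈⟨ +-cong (ι-weighted-bernUpTo M m) (ι-weighted-[ bernoulli (suc m) ] M (length (bernUpTo m))) ⟩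
    sumTo m (λ k → nat (suc M C k) * ι (bernoulli k)) + nat (suc M C length (bernUpTo m)) * ι (bernoulli (suc m))
      ≡⟨ cong (λ l → sumTo m (λ k → nat (suc M C k) * ι (bernoulli k)) + nat (suc M C l) * ι (bernoulli (suc m))) (length-bernUpTo m) ⟩
    sumTo (suc m) (λ k → nat (suc M C k) * ι (bernoulli k)) ∎

  bernoulli-recurrence : ∀ m → sumTo (suc m) (λ k → nat (suc (suc m) C k) * ι (bernoulli k)) ≈ 0#
  bernoulli-recurrence m = begin
    sumTo m (λ k → nat (suc (suc m) C k) * ι (bernoulli k)) + nat (suc (suc m) C suc m) * ι (bernoulli (suc m))
      ≈⟨ +-cong (sym (ι-weighted-bernUpTo (suc m) m)) (*-cong (nat-cong m+2Cm+1≡m+2) (reflexive (cong ι (bernoulli-suc m)))) ⟩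
    ι W + nat (suc (suc m)) * ι (ℚ.- (d ℚ.* W))
      ≈⟨ +-congˡ (*-congˡ (trans (-‿homo _) (-‿cong (*-homo d W)))) ⟩
    ι W + nat (suc (suc m)) * (- (ι d * ι W))
      ≈⟨ solve 3 (λ w n d → w :+ n :* (:- (d :* w)) := w :- (d :* n) :* w) refl _ _ _ ⟩
    ι W - (ι d * nat (suc (suc m))) * ι W
      ≈⟨ +-congˡ (-‿cong (*-congʳ (ι-inverse-nat (suc m)))) ⟩
    ι W - 1# * ι W
      ≈⟨ trans (+-congˡ (-‿cong (*-identityˡ _))) (-‿inverseʳ _) ⟩
    0# ∎
    where
    W = weighted (suc m) 0 (bernUpTo m)
    d = + 1 ℚ./ suc (suc m)
    m+2Cm+1≡m+2 : suc (suc m) C suc m ≡ suc (suc m)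
    m+2Cm+1≡m+2 = ≡.trans (nCk≡nC[n∸k] (N.n≤1+n (suc m))) (≡.trans (cong (suc (suc m) C_) (N.m+n∸n≡m 1 m)) (nC1≡n (suc (suc m))))

  δ₁ : ℕ → Carrier
  δ₁ 1 = 1#
  δ₁ _ = 0#

  bernoulli-binomialSum : ∀ N → sumTo N (λ k → nat (N C k) * ι (bernoulli k)) ≈ ι (bernoulli N) + δ₁ N
  bernoulli-binomialSum zero = trans (*-congʳ 1#-homo) (trans (*-identityˡ _) (sym (+-identityʳ _)))
  bernoulli-binomialSum (suc zero) = begin
    nat 1 * ι 1ℚ + nat 1 * ι (bernoulli 1) ≈⟨ +-cong (*-cong 1#-homo 1#-homo) (*-congʳ 1#-homo) ⟩
    1# * 1# + 1# * ι (bernoulli 1)          ≈⟨ +-cong (*-identityˡ 1#) (*-identityˡ _) ⟩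
    1# + ι (bernoulli 1)                     ≈⟨ +-comm _ _ ⟩
    ι (bernoulli 1) + 1#                     ∎
  bernoulli-binomialSum (suc (suc m)) = begin
    sumTo (suc m) (λ k → nat (suc (suc m) C k) * ι (bernoulli k)) + nat (suc (suc m) C suc (suc m)) * ι (bernoulli (suc (suc m)))
      ≈⟨ +-cong (bernoulli-recurrence m) (*-congʳ (trans (nat-cong (nCn≡1 (suc (suc m)))) 1#-homo)) ⟩
    0# + 1# * ι (bernoulli (suc (suc m)))
      ≈⟨ trans (+-identityˡ _) (*-identityˡ _) ⟩
    ι (bernoulli (suc (suc m)))
      ≈⟨ +-identityʳ _ ⟨
    ι (bernoulli (suc (suc m))) + 0# ∎

  -- appell (scaledBernoulli h) n z is the homogenised Bernoulli polynomial hⁿ Bₙ(z/h).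
  scaledBernoulli : Carrier → ℕ → Carrier
  scaledBernoulli h m = ι (bernoulli m) * pow h m

  appell-scaledBernoulli-self : ∀ N h → appell (scaledBernoulli h) N h ≈ pow h N * (ι (bernoulli N) + δ₁ N)
  appell-scaledBernoulli-self N h = begin
    appell (scaledBernoulli h) N h
      ≈⟨ sumTo-cong-≤ N collect ⟩
    sumTo N (λ m → pow h N * (nat (N C m) * ι (bernoulli m)))
      ≈⟨ *-distribˡ-sumTo N (pow h N) _ ⟨
    pow h N * sumTo N (λ m → nat (N C m) * ι (bernoulli m))
      ≈⟨ *-congˡ (bernoulli-binomialSum N) ⟩
    pow h N * (ι (bernoulli N) + δ₁ N) ∎
    where
    collect : ∀ m → m N.≤ N → nat (N C m) * (ι (bernoulli m) * pow h m * pow h (N ∸ m)) ≈ pow h N * (nat (N C m) * ι (bernoulli m))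
    collect m m≤N = begin
      nat (N C m) * (ι (bernoulli m) * pow h m * pow h (N ∸ m))
        ≈⟨ *-congˡ (*-assoc _ _ _) ⟩
      nat (N C m) * (ι (bernoulli m) * (pow h m * pow h (N ∸ m)))
        ≈⟨ *-congˡ (*-congˡ (pow-+ h m (N ∸ m))) ⟨
      nat (N C m) * (ι (bernoulli m) * pow h (m N.+ (N ∸ m)))
        ≡⟨ cong (λ e → nat (N C m) * (ι (bernoulli m) * pow h e)) (N.m+[n∸m]≡n m≤N) ⟩
      nat (N C m) * (ι (bernoulli m) * pow h N)
        ≈⟨ solve 3 (λ C b p → C :* (b :* p) := p :* (C :* b)) refl _ _ _ ⟩
      pow h N * (nat (N C m) * ι (bernoulli m)) ∎

  sumTo-δ₁ : ∀ n (f : ℕ → Carrier) → sumTo n (λ k → nat (n C k) * (δ₁ k * f k)) ≈ nat n * f 1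
  sumTo-δ₁ zero    f = trans (*-congˡ (zeroˡ _)) (trans (zeroʳ _) (sym (trans (*-congʳ 0#-homo) (zeroˡ _))))
  sumTo-δ₁ (suc m) f = begin
    sumTo (suc m) (λ k → nat (suc m C k) * (δ₁ k * f k))
      ≈⟨ sumTo-sucˡ m _ ⟩
    nat 1 * (0# * f 0) + sumTo m (λ k → nat (suc m C suc k) * (δ₁ (suc k) * f (suc k)))
      ≈⟨ +-cong (trans (*-congˡ (zeroˡ _)) (zeroʳ _)) (sumTo-head m _ (λ k → trans (*-congˡ (zeroˡ _)) (zeroʳ _))) ⟩
    0# + nat (suc m C 1) * (1# * f 1)
      ≈⟨ trans (+-identityˡ _) (*-cong (nat-cong (nC1≡n (suc m))) (*-identityˡ _)) ⟩
    nat (suc m) * f 1 ∎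

  appell-scaledBernoulli-+ : ∀ n h z →
    appell (scaledBernoulli h) n (z + h) ≈ appell (scaledBernoulli h) n z + nat n * (h * pow z (n ∸ 1))
  appell-scaledBernoulli-+ n h z = begin
    appell β n (z + h)
      ≈⟨ appell-cong β n (+-comm z h) ⟩
    appell β n (h + z)
      ≈⟨ appell-+ β n h z ⟩
    sumTo n (λ k → nat (n C k) * (pow z k * appell β (n ∸ k) h))
      ≈⟨ sumTo-cong-≤ n reindex ⟩
    sumTo n (λ k → G (n ∸ k))
      ≈⟨ sumTo-reverse n G ⟨
    sumTo n G
      ≈⟨ sumTo-+ n _ _ ⟩
    appell β n z + sumTo n (λ i → nat (n C i) * (δ₁ i * (pow h i * pow z (n ∸ i))))
      ≈⟨ +-congˡ (trans (sumTo-δ₁ n _) (*-congˡ (*-congʳ (*-identityʳ h)))) ⟩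
    appell β n z + nat n * (h * pow z (n ∸ 1)) ∎
    where
    β = scaledBernoulli h
    G : ℕ → Carrier
    G i = nat (n C i) * (β i * pow z (n ∸ i)) + nat (n C i) * (δ₁ i * (pow h i * pow z (n ∸ i)))
    reindex : ∀ k → k N.≤ n → nat (n C k) * (pow z k * appell β (n ∸ k) h) ≈ G (n ∸ k)
    reindex k k≤n = begin
      nat (n C k) * (pow z k * appell β (n ∸ k) h)
        ≈⟨ *-congˡ (*-congˡ (appell-scaledBernoulli-self (n ∸ k) h)) ⟩
      nat (n C k) * (pow z k * (pow h i * (ι (bernoulli i) + δ₁ i)))
        ≡⟨ ≡.cong₂ (λ a b → nat a * (pow z b * (pow h i * (ι (bernoulli i) + δ₁ i))))
             (nCk≡nC[n∸k] k≤n) (≡.sym (N.m∸[m∸n]≡n k≤n)) ⟩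
      nat (n C i) * (pow z (n ∸ i) * (pow h i * (ι (bernoulli i) + δ₁ i)))
        ≈⟨ solve 5 (λ C Z H b e → C :* (Z :* (H :* (b :+ e))) := C :* ((b :* H) :* Z) :+ C :* (e :* (H :* Z))) refl _ _ _ _ _ ⟩
      G i ∎
      where i = n ∸ k

  bernPoly-scale : ∀ N h x → pow h N * bernPoly N x ≈ appell (scaledBernoulli h) N (h * x)
  bernPoly-scale N h x = trans (*-distribˡ-sumTo N (pow h N) _) (sumTo-cong-≤ N distribute)
    where
    distribute : ∀ k → k N.≤ N →
      pow h N * (nat (N C k) * (ι (bernoulli k) * pow x (N ∸ k))) ≈ nat (N C k) * (scaledBernoulli h k * pow (h * x) (N ∸ k))
    distribute k k≤N = begin
      pow h N * (nat (N C k) * (ι (bernoulli k) * pow x (N ∸ k)))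
        ≡⟨ cong (λ e → pow h e * (nat (N C k) * (ι (bernoulli k) * pow x (N ∸ k)))) (N.m+[n∸m]≡n k≤N) ⟨
      pow h (k N.+ (N ∸ k)) * (nat (N C k) * (ι (bernoulli k) * pow x (N ∸ k)))
        ≈⟨ *-congʳ (pow-+ h k (N ∸ k)) ⟩
      pow h k * pow h (N ∸ k) * (nat (N C k) * (ι (bernoulli k) * pow x (N ∸ k)))
        ≈⟨ solve 5 (λ p q C b y → p :* q :* (C :* (b :* y)) := C :* ((b :* p) :* (q :* y))) refl _ _ _ _ _ ⟩
      nat (N C k) * (scaledBernoulli h k * (pow h (N ∸ k) * pow x (N ∸ k)))
        ≈⟨ *-congˡ (*-congˡ (pow-* h x (N ∸ k))) ⟨
      nat (N C k) * (scaledBernoulli h k * pow (h * x) (N ∸ k)) ∎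

  -- For t = ±√5 this is 2αⁿ resp. 2βⁿ, α, β = (1 ± √5)/2.
  lucFib : Carrier → ℕ → Carrier
  lucFib t n = nat (luc n) + t * nat (fib n)

  lucFib-fibonacciLike : ∀ t → IsFibonacciLike (lucFib t)
  lucFib-fibonacciLike t n = begin
    nat (luc (suc n) N.+ luc n) + t * nat (fib (suc n) N.+ fib n)
      ≈⟨ +-cong (nat-+ (luc (suc n)) (luc n)) (*-congˡ (nat-+ (fib (suc n)) (fib n))) ⟩
    (nat (luc (suc n)) + nat (luc n)) + t * (nat (fib (suc n)) + nat (fib n))
      ≈⟨ solve 5 (λ a b t c d → (a :+ b) :+ t :* (c :+ d) := (a :+ t :* c) :+ (b :+ t :* d)) refl _ _ _ _ _ ⟩
    lucFib t (suc n) + lucFib t n ∎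

  lucFib-0 : ∀ t → lucFib t 0 ≈ nat 2
  lucFib-0 = solve 1 (λ t → con (ℕtoℚ 2) :+ t :* con 0ℚ := con (ℕtoℚ 2)) refl

  lucFib-* : ∀ {t} → t * t ≈ nat 5 → ∀ i j → lucFib t i * lucFib t j ≈ nat 2 * lucFib t (i N.+ j)
  lucFib-* {t} t²≈5 i j = fibonacciLike-unique
    (fibonacciLike-*ʳ (lucFib t j) (lucFib-fibonacciLike t))
    (fibonacciLike-*ˡ (nat 2) (λ n → lucFib-fibonacciLike t (n N.+ j)))
    (*-congʳ (lucFib-0 t))
    (lucFib-1-* j)
    i
    where
    lucFib-1-* : ∀ j → lucFib t 1 * lucFib t j ≈ nat 2 * lucFib t (suc j)
    lucFib-1-* = fibonacciLike-unique
      (fibonacciLike-*ˡ (lucFib t 1) (lucFib-fibonacciLike t))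
      (fibonacciLike-*ˡ (nat 2) (λ n → lucFib-fibonacciLike t (suc n)))
      (trans (*-congˡ (lucFib-0 t)) (*-comm _ _))
      (begin
        lucFib t 1 * lucFib t 1                         ≈⟨ solve 1 (λ t → (con 1ℚ :+ t :* con 1ℚ) :* (con 1ℚ :+ t :* con 1ℚ) := con 1ℚ :+ con (ℕtoℚ 2) :* t :+ t :* t) refl t ⟩
        ι 1ℚ + nat 2 * t + t * t                         ≈⟨ +-congˡ t²≈5 ⟩
        ι 1ℚ + nat 2 * t + nat 5                         ≈⟨ solve 1 (λ t → con 1ℚ :+ con (ℕtoℚ 2) :* t :+ con (ℕtoℚ 5) := con (ℕtoℚ 2) :* (con (ℕtoℚ 3) :+ t :* con 1ℚ)) refl t ⟩
        nat 2 * lucFib t 2                               ∎)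

  lucFib-pow : ∀ {t} → t * t ≈ nat 5 → ∀ j k → nat 2 * pow (lucFib t j) k ≈ pow (nat 2) k * lucFib t (j N.* k)
  lucFib-pow t²≈5 = pow-scaledMultiplicative (lucFib-* t²≈5) (lucFib-0 _)

  lucFib-pow-difference : ∀ {s} → s * s ≈ nat 5 → ∀ j k →
    pow (lucFib s j) k ≈ pow (lucFib (- s) j) k + s * (pow (nat 2) k * nat (fib (j N.* k)))
  lucFib-pow-difference {s} s²≈5 j k = *-cancelˡ-invertible (ι-inverse-nat 1) (begin
    nat 2 * pow (lucFib s j) k
      ≈⟨ lucFib-pow s²≈5 j k ⟩
    P * lucFib s (j N.* k)
      ≈⟨ solve 4 (λ P L F s → P :* (L :+ s :* F) := P :* (L :+ (:- s) :* F) :+ con (ℕtoℚ 2) :* (s :* (P :* F))) refl _ _ _ _ ⟩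
    P * lucFib (- s) (j N.* k) + nat 2 * (s * (P * F))
      ≈⟨ +-congʳ (lucFib-pow -s²≈5 j k) ⟨
    nat 2 * pow (lucFib (- s) j) k + nat 2 * (s * (P * F))
      ≈⟨ distribˡ _ _ _ ⟨
    nat 2 * (pow (lucFib (- s) j) k + s * (P * F)) ∎)
    where
    P = pow (nat 2) k
    F = nat (fib (j N.* k))
    -s²≈5 : - s * - s ≈ nat 5
    -s²≈5 = trans (solve 1 (λ s → (:- s) :* (:- s) := s :* s) refl s) s²≈5

theorem17 : ∀ {c ℓ} (R : CommutativeRing c ℓ) (ι : ℚ → CommutativeRing.Carrier R)
  → RingMorphisms.IsRingHomomorphism (CommutativeRing.rawRing +-*-commutativeRing) (CommutativeRing.rawRing R) ι
  → (s : CommutativeRing.Carrier R)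
  → CommutativeRing._≈_ R (CommutativeRing._*_ R s s) (QAlgebra.nat R ι 5)
  → (n j : ℕ) → 1 ≤ j → (x : CommutativeRing.Carrier R)
  → let open CommutativeRing R
        open QAlgebra R ι
    in sumTo n (λ k → nat (n C k) * (pow (nat 2) k * (nat (fib (j N.* k)) * (pow (s * nat (fib j)) (n ∸ k) * bernPoly (n ∸ k) x))))
       ≈ nat n * (nat (fib j) * (pow (s * nat (fib j) * x + nat (luc j)) (n ∸ 1) + pow (s * nat (fib j) * (x - 1#) + nat (luc j)) (n ∸ 1)))
theorem17 R ι ι-hom s s²≈5 n j _ x =
  *-cancelˡ-invertible s⁻¹*s≈1 (+-cancelˡ (appell β n w) _ _ (begin
    appell β n w + s * lhs
      ≈⟨ +-cong (appell-cong β n (sym hx+v≈w)) s*lhs ⟩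
    appell β n (h * x + v) + sumTo n (λ k → nat (n C k) * (d k * appell β (n ∸ k) (h * x)))
      ≈⟨ appell-+-powDifference β n (h * x) u v d (lucFib-pow-difference s²≈5 j) ⟨
    appell β n (h * x + u)
      ≈⟨ appell-cong β n hx+u≈w+h+h ⟩
    appell β n ((w + h) + h)
      ≈⟨ trans (appell-scaledBernoulli-+ n h (w + h)) (+-congʳ (appell-scaledBernoulli-+ n h w)) ⟩
    (appell β n w + nat n * (h * pow w (n ∸ 1))) + nat n * (h * pow (w + h) (n ∸ 1))
      ≈⟨ trans (+-assoc _ _ _) (+-congˡ (sym s*rhs)) ⟩
    appell β n w + s * rhs ∎))
  where
  open CommutativeRing R
  open QAlgebra R ι
  open RingMorphisms.IsRingHomomorphism ι-hom using (1#-homo)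
  open SumsAndPowers R ι
  open QAlgebraProperties R ι ι-hom
  open Solver using (solve; _:+_; _:*_; _:-_; :-_; _:=_; con)
  open SetoidReasoning setoid
  open GroupProperties +-group using () renaming (∙-cancelˡ to +-cancelˡ)
  f = nat (fib j)
  l = nat (luc j)
  h = s * f
  u = lucFib s j
  v = lucFib (- s) j
  w = h * (x - 1#) + l
  β = scaledBernoulli h
  d : ℕ → Carrier
  d k = s * (pow (nat 2) k * nat (fib (j N.* k)))
  lhs = sumTo n (λ k → nat (n C k) * (pow (nat 2) k * (nat (fib (j N.* k)) * (pow h (n ∸ k) * bernPoly (n ∸ k) x))))
  rhs = nat n * (f * (pow (h * x + l) (n ∸ 1) + pow w (n ∸ 1)))
  s⁻¹*s≈1 : ι (+ 1 ℚ./ 5) * s * s ≈ 1#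
  s⁻¹*s≈1 = trans (*-assoc _ _ _) (trans (*-congˡ s²≈5) (ι-inverse-nat 4))
  s*lhs : s * lhs ≈ sumTo n (λ k → nat (n C k) * (d k * appell β (n ∸ k) (h * x)))
  s*lhs = trans (*-distribˡ-sumTo n s _) (sumTo-cong n (λ k →
    trans (solve 5 (λ s C P F Y → s :* (C :* (P :* (F :* Y))) := C :* ((s :* (P :* F)) :* Y)) refl _ _ _ _ _)
          (*-congˡ (*-congˡ (bernPoly-scale (n ∸ k) h x)))))
  w≈ : h * (x - ι 1ℚ) + l ≈ w
  w≈ = +-congʳ (*-congˡ (+-congˡ (-‿cong 1#-homo)))
  hx+v≈w : h * x + v ≈ w
  hx+v≈w = trans (solve 4 (λ s f x l → (s :* f) :* x :+ (l :+ (:- s) :* f) := (s :* f) :* (x :- con 1ℚ) :+ l) refl s f x l) w≈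
  hx+u≈w+h+h : h * x + u ≈ (w + h) + h
  hx+u≈w+h+h = trans (solve 4 (λ s f x l → (s :* f) :* x :+ (l :+ s :* f) := ((s :* f) :* (x :- con 1ℚ) :+ l :+ s :* f) :+ s :* f) refl s f x l)
                     (+-congʳ (+-congʳ w≈))
  hx+l≈w+h : h * x + l ≈ w + h
  hx+l≈w+h = trans (solve 4 (λ s f x l → (s :* f) :* x :+ l := (s :* f) :* (x :- con 1ℚ) :+ l :+ s :* f) refl s f x l) (+-congʳ w≈)
  s*rhs : s * rhs ≈ nat n * (h * pow w (n ∸ 1)) + nat n * (h * pow (w + h) (n ∸ 1))
  s*rhs = trans (solve 5 (λ s N f A B → s :* (N :* (f :* (A :+ B))) := N :* ((s :* f) :* B) :+ N :* ((s :* f) :* A)) refl s (nat n) f _ _)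
                (+-congˡ (*-congˡ (*-congˡ (pow-cong (n ∸ 1) hx+l≈w+h))))
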